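{- The normal product $\underline{\boxtimes}$ of hypergraphs is associative: for all hypergraphs $H_1=(V_1,E_1)$, $H_2=(V_2,E_2)$, $H_3=(V_3,E_3)$, the map $((x,y),z)\mapsto(x,(y,z))$ is an isomorphism from $(H_1\,\underline{\boxtimes}\,H_2)\,\underline{\boxtimes}\,H_3$ to $H_1\,\underline{\boxtimes}\,(H_2\,\underline{\boxtimes}\,H_3)$; in particular these hypergraphs are isomorphic.
   Context: A (finite) hypergraph $H=(V,E)$ consists of a finite vertex set $V$ and a collection $E$ of non-empty subsets of $V$. An isomorphism is a bijection on vertices which, together with its inverse, maps edges to edges. For hypergraphs $H_1=(V_1,E_1)$, $H_2=(V_2,E_2)$ all products below have vertex set $V_1\times V_2$; $p_i$ is projection onto the $i$-th coordinate. Cartesian product $H_1\Box H_2$: edges $\{\{v\}\times f : v\in V_1, f\in E_2\}\cup\{e\times\{w\} : e\in E_1, w\in V_2\}$. Minimal rank preserving direct product $H_1\,\underline{\times}\,H_2$: for $e_1\in E_1,e_2\in E_2$ let $r^{ - }_{e_1,e_2}=\min\{|e_1|,|e_2|\}$; edges are all $e\subseteq e_1\times e_2$ ($e_1\in E_1,e_2\in E_2$) with $|e|=r^{ - }_{e_1,e_2}$ and $|p_i(e)|=r^{ - }_{e_1,e_2}$ for $i=1,2$. Normal product $H_1\,\underline{\boxtimes}\,H_2$: edge set $E(H_1\Box H_2)\cup E(H_1\,\underline{\times}\,H_2)$. -}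

module Defs where

open import Data.Nat using (ℕ; zero; suc; _+_; _*_; _⊓_)
open import Data.Bool using (Bool; true; false; _∧_; _∨_; if_then_else_)
open import Data.Fin using (Fin; zero; suc)
import Data.Fin as F
open import Data.Fin.Properties using (*↔×)
open import Data.Product using (Σ; Σ-syntax; ∃; _×_; _,_; proj₁; proj₂)
open import Data.Product.Function.NonDependent.Propositional using (_×-cong_)
open import Data.Sum using (_⊎_)
open import Function.Bundles using (_↔_; Inverse; mk↔ₛ′)
open import Function.Properties.Inverse using (↔-trans)
open import Relation.Binary.PropositionalEquality using (_≡_; refl)
open import Relation.Nullary.Decidable using (⌊_⌋)

-- A subset of V is a Boolean predicate V → Bool, and
-- the edge collection E is a predicate on subsets ("e ∈ E").

record Hypergraph : Set₁ where
  field
    V    : Set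
    size : ℕ
    enum : Fin size ↔ V
    E    : (V → Bool) → Set
open Hypergraph public

index : (H : Hypergraph) → V H → Fin (size H)
index H = Inverse.from (enum H)

vertex : (H : Hypergraph) → Fin (size H) → V H
vertex H = Inverse.to (enum H)

eqV : (H : Hypergraph) → V H → V H → Bool
eqV H x y = ⌊ index H x F.≟ index H y ⌋

countFin : (n : ℕ) → (Fin n → Bool) → ℕ
countFin zero    p = 0
countFin (suc n) p = (if p zero then 1 else 0) + countFin n (λ i → p (suc i))

anyFin : (n : ℕ) → (Fin n → Bool) → Bool
anyFin zero    p = false
anyFin (suc n) p = p zero ∨ anyFin n (λ i → p (suc i))

card : (H : Hypergraph) → (V H → Bool) → ℕ
card H s = countFin (size H) (λ i → s (vertex H i))

-- A hypergraph in the paper's sense: every edge is non-empty.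
NonEmptyEdges : Hypergraph → Set
NonEmptyEdges H = ∀ e → E H e → Σ[ v ∈ V H ] e v ≡ true

prodEnum : (H K : Hypergraph) → Fin (size H * size K) ↔ (V H × V K)
prodEnum H K = ↔-trans *↔× (enum H ×-cong enum K)

p₁ : (H K : Hypergraph) → (V H × V K → Bool) → V H → Bool
p₁ H K s x = anyFin (size K) (λ j → s (x , vertex K j))

p₂ : (H K : Hypergraph) → (V H × V K → Bool) → V K → Bool
p₂ H K s y = anyFin (size H) (λ i → s (vertex H i , y))

CartEdge : (H K : Hypergraph) → (V H × V K → Bool) → Set
CartEdge H K s =
    (Σ[ v ∈ V H ] Σ[ f ∈ (V K → Bool) ] E K f ×
       (∀ x y → s (x , y) ≡ (eqV H x v ∧ f y)))
  ⊎ (Σ[ e ∈ (V H → Bool) ] Σ[ w ∈ V K ] E H e ×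
       (∀ x y → s (x , y) ≡ (e x ∧ eqV K y w)))

cardProd : (H K : Hypergraph) → (V H × V K → Bool) → ℕ
cardProd H K s = countFin (size H * size K) (λ i → s (Inverse.to (prodEnum H K) i))

DirEdge : (H K : Hypergraph) → (V H × V K → Bool) → Set
DirEdge H K s =
  Σ[ e₁ ∈ (V H → Bool) ] Σ[ e₂ ∈ (V K → Bool) ] E H e₁ × E K e₂ ×
    (∀ x y → s (x , y) ≡ true → (e₁ x ≡ true × e₂ y ≡ true)) ×
    cardProd H K s ≡ (card H e₁ ⊓ card K e₂) ×
    card H (p₁ H K s) ≡ (card H e₁ ⊓ card K e₂) ×
    card K (p₂ H K s) ≡ (card H e₁ ⊓ card K e₂)

_⊠_ : Hypergraph → Hypergraph → Hypergraph
H ⊠ K = record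
  { V    = V H × V K
  ; size = size H * size K
  ; enum = prodEnum H K
  ; E    = λ s → CartEdge H K s ⊎ DirEdge H K s
  }

-- Isomorphisms: a bijection φ on vertices such that φ and φ⁻¹ map edges
-- to edges.  The image of a subset e under φ is e ∘ φ⁻¹.

IsIsomorphism : (H K : Hypergraph) → (φ : V H ↔ V K) → Set
IsIsomorphism H K φ =
    (∀ e → E H e → E K (λ y → e (Inverse.from φ y)))
  × (∀ f → E K f → E H (λ x → f (Inverse.to φ x)))

Isomorphic : Hypergraph → Hypergraph → Set
Isomorphic H K = Σ[ φ ∈ (V H ↔ V K) ] IsIsomorphism H K φ

assoc↔ : {A B C : Set} → ((A × B) × C) ↔ (A × (B × C))
assoc↔ = mk↔ₛ′ (λ { ((x , y) , z) → (x , (y , z)) })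
                (λ { (x , (y , z)) → ((x , y) , z) })
                (λ _ → refl) (λ _ → refl)

-- An edge of (H₁ ⊠ H₂) ⊠ H₃ has one of seven shapes: a Cartesian edge {v} × f, or e' × {w} or
-- a direct edge over e', where e' is itself a Cartesian or direct edge of H₁ ⊠ H₂.  In each case
-- the reassociated set is an edge of H₁ ⊠ (H₂ ⊠ H₃) of the matching shape.  Direct edges are
-- best seen as matchings: |s| = |p₁ s| = |p₂ s| says that s is the graph of a bijection
-- p₁ s → p₂ s, so a direct edge is a matching of size min |e₁| |e₂| inside e₁ × e₂.  The only
-- case needing a construction is a direct edge over a direct edge: its trace on H₂ × H₃ is a
-- matching between e₂ and e₃ that need not be maximum, so it is extended by pairing the
-- unmatched vertices in order; the sizes then agree by associativity of min.  The inverse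
-- direction is the forward one for H₃, H₂, H₁, transported along the commutativity of ⊠.

module Submission where

open import Defs
open import Data.Bool using (Bool; true; false; _∧_; _∨_; not; if_then_else_)
open import Data.Bool.Properties using (∧-zeroʳ; ∧-assoc; ∧-comm; ¬-not)
import Data.Bool as B
open import Data.Empty using (⊥-elim)
open import Data.Fin using (Fin; zero; suc; toℕ; fromℕ<)
import Data.Fin as F
open import Data.Fin.Properties using (toℕ<n; toℕ-fromℕ<; toℕ-injective; injective⇒≤)
open import Data.Nat using (ℕ; zero; suc; _+_; _⊓_; _≤_; _<_; z≤n; s≤s)
import Data.Nat as ℕ
open import Data.Nat.Properties using (⊓-assoc; ⊓-comm; ≤-reflexive; ≤-total; m≤n⇒m⊓n≡m; m≥n⇒m⊓n≡n; <-≤-trans; ≤-antisym; ≤-trans; ≤-<-trans; <-irrefl; m≤n⇒m≤1+n; suc-injective; 0≢1+n)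
open import Data.Product using (_×_; _,_; proj₁; proj₂; ∃; uncurry; swap; map₁)
open import Data.Product.Algebra using (×-comm)
open import Data.Product.Function.NonDependent.Propositional using (_×-cong_)
open import Data.Sum using (_⊎_; inj₁; inj₂)
open import Function using (_∘_; case_of_)
open import Function.Bundles using (_↔_; Inverse; Injection)
open import Function.Properties.Inverse using (↔-refl; ↔-sym; ↔⇒↣)
open import Relation.Binary.PropositionalEquality
open import Relation.Nullary using (¬_; Dec; yes; no)
open import Relation.Nullary.Decidable using (⌊_⌋)

infix 4 _∈_ _⊆_

_∈_ : {A : Set} → A → (A → Bool) → Set
x ∈ s = s x ≡ true

_⊆_ : {A : Set} → (A → Bool) → (A → Bool) → Set
s ⊆ t = ∀ x → x ∈ s → x ∈ t

∧-true⁻ : ∀ {a b} → a ∧ b ≡ true → a ≡ true × b ≡ true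
∧-true⁻ {true} p = refl , p

∧-true⁺ : ∀ {a b} → a ≡ true → b ≡ true → a ∧ b ≡ true
∧-true⁺ refl p = p

∨-true⁻ : ∀ {a b} → a ∨ b ≡ true → a ≡ true ⊎ b ≡ true
∨-true⁻ {true}  _ = inj₁ refl
∨-true⁻ {false} p = inj₂ p

∨-true⁺ˡ : ∀ {a b} → a ≡ true → a ∨ b ≡ true
∨-true⁺ˡ refl = refl

∨-true⁺ʳ : ∀ {a b} → b ≡ true → a ∨ b ≡ true
∨-true⁺ʳ {true}  _ = refl
∨-true⁺ʳ {false} p = p

not-true⁻ : ∀ {a} → not a ≡ true → a ≡ false
not-true⁻ {false} _ = refl

not-true⁺ : ∀ {a} → a ≡ false → not a ≡ true
not-true⁺ refl = refl

≡true⇒≢false : ∀ {a} → a ≡ true → ¬ a ≡ false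
≡true⇒≢false refl ()

≡true-ext : ∀ {a b} → (a ≡ true → b ≡ true) → (b ≡ true → a ≡ true) → a ≡ b
≡true-ext {true}  {true}  _ _ = refl
≡true-ext {true}  {false} f _ = sym (f refl)
≡true-ext {false} {true}  _ g = g refl
≡true-ext {false} {false} _ _ = refl

isYes⁻ : ∀ {A : Set} (d : Dec A) → ⌊ d ⌋ ≡ true → A
isYes⁻ (yes a) _ = a

isYes⁺ : ∀ {A : Set} (d : Dec A) → A → ⌊ d ⌋ ≡ true
isYes⁺ (yes _) _ = refl
isYes⁺ (no ¬a) a = ⊥-elim (¬a a)

module _ (H : Hypergraph) where

  vertex-index : ∀ x → vertex H (index H x) ≡ x
  vertex-index = Inverse.strictlyInverseˡ (enum H)

  index-vertex : ∀ i → index H (vertex H i) ≡ i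
  index-vertex = Inverse.strictlyInverseʳ (enum H)

  index-injective : ∀ {x y} → index H x ≡ index H y → x ≡ y
  index-injective {x} {y} p = begin
    x                        ≡⟨ sym (vertex-index x) ⟩
    vertex H (index H x)     ≡⟨ cong (vertex H) p ⟩
    vertex H (index H y)     ≡⟨ vertex-index y ⟩
    y                        ∎
    where open ≡-Reasoning

  eqV-sound : ∀ {x y} → eqV H x y ≡ true → x ≡ y
  eqV-sound {x} {y} p = index-injective (isYes⁻ (index H x F.≟ index H y) p)

  eqV-refl : ∀ x → eqV H x x ≡ true
  eqV-refl x = isYes⁺ (index H x F.≟ index H x) refl

  eqV-complete : ∀ {x y} → x ≡ y → eqV H x y ≡ true
  eqV-complete {x} refl = eqV-refl x

rank : (n : ℕ) → (Fin n → Bool) → Fin n → ℕ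
rank (suc n) p zero    = 0
rank (suc n) p (suc i) = (if p zero then 1 else 0) + rank n (p ∘ suc) i

rank-suc : ∀ n p i → p zero ≡ true → rank (suc n) p (suc i) ≡ suc (rank n (p ∘ suc) i)
rank-suc n p i p0 rewrite p0 = refl

rank-< : ∀ n p {i} → p i ≡ true → rank n p i < countFin n p
rank-< (suc n) p {zero} pi rewrite pi = s≤s z≤n
rank-< (suc n) p {suc i} pi with p zero
... | true  = s≤s (rank-< n (p ∘ suc) pi)
... | false = rank-< n (p ∘ suc) pi

rank-injective : ∀ n p {i j} → p i ≡ true → p j ≡ true → rank n p i ≡ rank n p j → i ≡ j
rank-injective (suc n) p {zero}  {zero}  _  _  _ = refl
rank-injective (suc n) p {zero}  {suc j} p0 _  r = ⊥-elim (0≢1+n (trans r (rank-suc n p j p0)))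
rank-injective (suc n) p {suc i} {zero}  _  p0 r = ⊥-elim (0≢1+n (trans (sym r) (rank-suc n p i p0)))
rank-injective (suc n) p {suc i} {suc j} pi pj r with p zero
... | true  = cong suc (rank-injective n (p ∘ suc) pi pj (suc-injective r))
... | false = cong suc (rank-injective n (p ∘ suc) pi pj r)

rank-surjective : ∀ n p {k} → k < countFin n p → ∃ λ i → p i ≡ true × rank n p i ≡ k
rank-surjective (suc n) p {k} k< with p zero in p0
rank-surjective (suc n) p {zero}  _         | true = zero , p0 , refl
rank-surjective (suc n) p {suc k} (s≤s k<) | true with rank-surjective n (p ∘ suc) k<
... | i , pi , r = suc i , pi , trans (rank-suc n p i p0) (cong suc r)
rank-surjective (suc n) p {k}     k<        | false with rank-surjective n (p ∘ suc) k<
... | i , pi , r = suc i , pi , trans (cong (λ b → (if b then 1 else 0) + rank n (p ∘ suc) i) p0) r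

countFin-mono : ∀ n p q → (∀ i → p i ≡ true → q i ≡ true) → countFin n p ≤ countFin n q
countFin-mono zero    p q p⊆q = z≤n
countFin-mono (suc n) p q p⊆q with p zero in p0 | q zero in q0
... | true  | true  = s≤s (countFin-mono n (p ∘ suc) (q ∘ suc) (p⊆q ∘ suc))
... | true  | false = ⊥-elim (≡true⇒≢false (p⊆q zero p0) q0)
... | false | true  = m≤n⇒m≤1+n (countFin-mono n (p ∘ suc) (q ∘ suc) (p⊆q ∘ suc))
... | false | false = countFin-mono n (p ∘ suc) (q ∘ suc) (p⊆q ∘ suc)

countFin-< : ∀ n p q → (∀ i → p i ≡ true → q i ≡ true) →
             ∀ i → q i ≡ true → p i ≡ false → countFin n p < countFin n q
countFin-< (suc n) p q p⊆q zero qi pi rewrite qi | pi = s≤s (countFin-mono n (p ∘ suc) (q ∘ suc) (p⊆q ∘ suc))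
countFin-< (suc n) p q p⊆q (suc i) qi pi with p zero in p0 | q zero in q0
... | true  | true  = s≤s (countFin-< n (p ∘ suc) (q ∘ suc) (p⊆q ∘ suc) i qi pi)
... | true  | false = ⊥-elim (≡true⇒≢false (p⊆q zero p0) q0)
... | false | true  = m≤n⇒m≤1+n (countFin-< n (p ∘ suc) (q ∘ suc) (p⊆q ∘ suc) i qi pi)
... | false | false = countFin-< n (p ∘ suc) (q ∘ suc) (p⊆q ∘ suc) i qi pi

MapsInto : {A B : Set} → (A → B) → (A → Bool) → (B → Bool) → Set
MapsInto f s t = ∀ x → x ∈ s → f x ∈ t

InjectiveOn : {A B : Set} → (A → B) → (A → Bool) → Set
InjectiveOn f s = ∀ {x x'} → x ∈ s → x' ∈ s → f x ≡ f x' → x ≡ x'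

Onto : {A B : Set} → (A → B) → (A → Bool) → (B → Bool) → Set
Onto f s t = ∀ y → y ∈ t → ∃ λ x → x ∈ s × f x ≡ y

module _ (H : Hypergraph) (s : V H → Bool) where

  position : V H → ℕ
  position x = rank (size H) (s ∘ vertex H) (index H x)

  private
    ∈⇒index∈ : ∀ {x} → x ∈ s → s (vertex H (index H x)) ≡ true
    ∈⇒index∈ {x} = subst (_∈ s) (sym (vertex-index H x))

  position-< : ∀ {x} → x ∈ s → position x < card H s
  position-< x∈s = rank-< (size H) (s ∘ vertex H) (∈⇒index∈ x∈s)

  position-injective : InjectiveOn position s
  position-injective x∈s x'∈s p =
    index-injective H (rank-injective (size H) (s ∘ vertex H) (∈⇒index∈ x∈s) (∈⇒index∈ x'∈s) p)

  position-surjective : ∀ {k} → k < card H s → ∃ λ x → x ∈ s × position x ≡ k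
  position-surjective k< with rank-surjective (size H) (s ∘ vertex H) k<
  ... | i , i∈s , r = vertex H i , i∈s , trans (cong (rank (size H) (s ∘ vertex H)) (index-vertex H i)) r

module _ (H K : Hypergraph) {s : V H → Bool} {t : V K → Bool} where

  -- f is dependent so that it can be a section chosen from an Onto proof.
  card-≤-injection : (f : ∀ x → x ∈ s → V K) → (∀ x p → f x p ∈ t) →
                     (∀ {x x'} p p' → f x p ≡ f x' p' → x ≡ x') → card H s ≤ card K t
  card-≤-injection f f∈t f-inj = injective⇒≤ F-injective
    where
    pick : (k : Fin (card H s)) → ∃ λ x → x ∈ s × position H s x ≡ toℕ k
    pick k = position-surjective H s (toℕ<n k)

    image : Fin (card H s) → V K
    image k = f (proj₁ (pick k)) (proj₁ (proj₂ (pick k)))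

    F : Fin (card H s) → Fin (card K t)
    F k = fromℕ< (position-< K t (f∈t _ _))

    F-injective : ∀ {k k'} → F k ≡ F k' → k ≡ k'
    F-injective {k} {k'} p = toℕ-injective (begin
      toℕ k                            ≡⟨ sym (proj₂ (proj₂ (pick k))) ⟩
      position H s (proj₁ (pick k))    ≡⟨ cong (position H s) (f-inj _ _ same-image) ⟩
      position H s (proj₁ (pick k'))   ≡⟨ proj₂ (proj₂ (pick k')) ⟩
      toℕ k'                           ∎)
      where
      open ≡-Reasoning
      same-image : image k ≡ image k'
      same-image = position-injective K t (f∈t _ _) (f∈t _ _)
        (trans (sym (toℕ-fromℕ< _)) (trans (cong toℕ p) (toℕ-fromℕ< _)))

  card-≤-surjection : (f : V K → V H) → Onto f t s → card H s ≤ card K t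
  card-≤-surjection f onto =
    card-≤-injection (λ x x∈s → proj₁ (onto x x∈s)) (λ x x∈s → proj₁ (proj₂ (onto x x∈s)))
      (λ {x} {x'} p p' q → trans (sym (proj₂ (proj₂ (onto x p))))
                             (trans (cong f q) (proj₂ (proj₂ (onto x' p')))))

card-≡-bijection : (H K : Hypergraph) {s : V H → Bool} {t : V K → Bool} (f : V H → V K) →
                   MapsInto f s t → InjectiveOn f s → Onto f s t → card H s ≡ card K t
card-≡-bijection H K {s} {t} f f∈t f-inj onto =
  ≤-antisym (card-≤-injection H K {s} {t} (λ x _ → f x) f∈t f-inj) (card-≤-surjection K H {t} {s} f onto)

card-preimage : (H K : Hypergraph) (φ : V H ↔ V K) (t : V K → Bool) → card H (t ∘ Inverse.to φ) ≡ card K t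
card-preimage H K φ t = card-≡-bijection H K {t ∘ Inverse.to φ} {t} (Inverse.to φ) (λ _ p → p)
  (λ _ _ → Injection.injective (↔⇒↣ φ))
  (λ y y∈t → Inverse.from φ y , subst (_∈ t) (sym (Inverse.strictlyInverseˡ φ y)) y∈t
                              , Inverse.strictlyInverseˡ φ y)

module _ (H : Hypergraph) where

  card-mono : ∀ {s t} → s ⊆ t → card H s ≤ card H t
  card-mono {s} {t} s⊆t = card-≤-injection H H {s} {t} (λ x _ → x) s⊆t (λ _ _ p → p)

  card-cong : ∀ {s t} → s ⊆ t → t ⊆ s → card H s ≡ card H t
  card-cong s⊆t t⊆s = ≤-antisym (card-mono s⊆t) (card-mono t⊆s)

  remove : (V H → Bool) → V H → V H → Bool
  remove s v x = s x ∧ not (eqV H x v)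

  card-remove-< : ∀ {s v} → v ∈ s → card H (remove s v) < card H s
  card-remove-< {s} {v} v∈s =
    countFin-< (size H) (remove s v ∘ vertex H) (s ∘ vertex H) (λ _ → proj₁ ∘ ∧-true⁻)
      (index H v) (at-index s v∈s) (at-index (remove s v) v∉removed)
    where
    at-index : ∀ (g : V H → Bool) {b} → g v ≡ b → g (vertex H (index H v)) ≡ b
    at-index g {b} = subst (λ u → g u ≡ b) (sym (vertex-index H v))
    v∉removed : s v ∧ not (eqV H v v) ≡ false
    v∉removed rewrite eqV-refl H v = ∧-zeroʳ (s v)

-- If x ≠ x' had the same image, f would still map s minus x' onto t, forcing card t < card s.
onto-card-≡⇒injectiveOn : (H K : Hypergraph) {s : V H → Bool} {t : V K → Bool} (f : V H → V K) →
                          Onto f s t → card H s ≡ card K t → InjectiveOn f s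
onto-card-≡⇒injectiveOn H K {s} {t} f onto s≡t {x} {x'} x∈s x'∈s fx≡fx' with eqV H x x' in x≟x'
... | true  = eqV-sound H x≟x'
... | false = ⊥-elim (<-irrefl (sym s≡t)
                (≤-<-trans (card-≤-surjection K H {t} {remove H s x'} f onto-without-x')
                           (card-remove-< H x'∈s)))
  where
  onto-without-x' : Onto f (remove H s x') t
  onto-without-x' y y∈t with onto y y∈t
  ... | z , z∈s , fz≡y with eqV H z x' in z≟x'
  ...   | true  = x , ∧-true⁺ x∈s (not-true⁺ x≟x')
                    , trans fx≡fx' (trans (cong f (sym (eqV-sound H z≟x'))) fz≡y)
  ...   | false = z , ∧-true⁺ z∈s (not-true⁺ z≟x') , fz≡y

infixr 7 _×ˢ_

_×ˢ_ : {A B : Set} → (A → Bool) → (B → Bool) → A × B → Bool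
(s ×ˢ t) w = s (proj₁ w) ∧ t (proj₂ w)

single : (H : Hypergraph) → V H → V H → Bool
single H v x = eqV H x v

anyFin⁺ : ∀ n p {i} → p i ≡ true → anyFin n p ≡ true
anyFin⁺ (suc n) p {zero}  pi = ∨-true⁺ˡ pi
anyFin⁺ (suc n) p {suc i} pi = ∨-true⁺ʳ {p zero} (anyFin⁺ n (p ∘ suc) pi)

anyFin⁻ : ∀ n p → anyFin n p ≡ true → ∃ λ i → p i ≡ true
anyFin⁻ (suc n) p q with ∨-true⁻ {p zero} q
... | inj₁ p0 = zero , p0
... | inj₂ ps with anyFin⁻ n (p ∘ suc) ps
...   | i , pi = suc i , pi

module _ (H K : Hypergraph) (s : V H × V K → Bool) where

  p₁⁺ : ∀ {x y} → (x , y) ∈ s → x ∈ p₁ H K s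
  p₁⁺ {x} {y} xy∈s = anyFin⁺ (size K) _ (subst (λ u → (x , u) ∈ s) (sym (vertex-index K y)) xy∈s)

  p₁⁻ : ∀ {x} → x ∈ p₁ H K s → ∃ λ y → (x , y) ∈ s
  p₁⁻ x∈p₁ with anyFin⁻ (size K) _ x∈p₁
  ... | j , xj∈s = vertex K j , xj∈s

  p₂⁺ : ∀ {x y} → (x , y) ∈ s → y ∈ p₂ H K s
  p₂⁺ {x} {y} xy∈s = anyFin⁺ (size H) _ (subst (λ u → (u , y) ∈ s) (sym (vertex-index H x)) xy∈s)

  p₂⁻ : ∀ {y} → y ∈ p₂ H K s → ∃ λ x → (x , y) ∈ s
  p₂⁻ y∈p₂ with anyFin⁻ (size H) _ y∈p₂
  ... | i , iy∈s = vertex H i , iy∈s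

eqV-⊠ : (H K : Hypergraph) (x x' : V H) (y y' : V K) →
        eqV (H ⊠ K) (x , y) (x' , y') ≡ (eqV H x x' ∧ eqV K y y')
eqV-⊠ H K x x' y y' = ≡true-ext
  (λ p → case eqV-sound (H ⊠ K) p of λ { refl → ∧-true⁺ (eqV-refl H x) (eqV-refl K y) })
  (λ p → let x≡x' , y≡y' = ∧-true⁻ p
         in eqV-complete (H ⊠ K) (cong₂ _,_ (eqV-sound H x≡x') (eqV-sound K y≡y')))

RightUnique : {A B : Set} → (A × B → Bool) → Set
RightUnique s = ∀ {x y y'} → (x , y) ∈ s → (x , y') ∈ s → y ≡ y'

LeftUnique : {A B : Set} → (A × B → Bool) → Set
LeftUnique s = ∀ {x x' y} → (x , y) ∈ s → (x' , y) ∈ s → x ≡ x'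

module _ (H K : Hypergraph) (s : V H × V K → Bool) where

  private
    proj₁-onto : Onto proj₁ s (p₁ H K s)
    proj₁-onto x x∈p₁ = let y , xy∈s = p₁⁻ H K s x∈p₁ in (x , y) , xy∈s , refl

    proj₂-onto : Onto proj₂ s (p₂ H K s)
    proj₂-onto y y∈p₂ = let x , xy∈s = p₂⁻ H K s y∈p₂ in (x , y) , xy∈s , refl

  rightUnique⇒card-p₁ : RightUnique s → card (H ⊠ K) s ≡ card H (p₁ H K s)
  rightUnique⇒card-p₁ ru = card-≡-bijection (H ⊠ K) H proj₁ (λ _ → p₁⁺ H K s) inj proj₁-onto
    where
    inj : InjectiveOn proj₁ s
    inj {x , _} {_ , _} p p' refl = cong (x ,_) (ru p p')

  leftUnique⇒card-p₂ : LeftUnique s → card (H ⊠ K) s ≡ card K (p₂ H K s)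
  leftUnique⇒card-p₂ lu = card-≡-bijection (H ⊠ K) K proj₂ (λ _ → p₂⁺ H K s) inj proj₂-onto
    where
    inj : InjectiveOn proj₂ s
    inj {_ , y} {_ , _} p p' refl = cong (_, y) (lu p p')

  card-p₁⇒rightUnique : card (H ⊠ K) s ≡ card H (p₁ H K s) → RightUnique s
  card-p₁⇒rightUnique s≡p₁ p p' =
    cong proj₂ (onto-card-≡⇒injectiveOn (H ⊠ K) H proj₁ proj₁-onto s≡p₁ p p' refl)

  card-p₂⇒leftUnique : card (H ⊠ K) s ≡ card K (p₂ H K s) → LeftUnique s
  card-p₂⇒leftUnique s≡p₂ p p' =
    cong proj₁ (onto-card-≡⇒injectiveOn (H ⊠ K) K proj₂ proj₂-onto s≡p₂ p p' refl)

-- DirEdge, restated: by the lemmas above, |s| = |p₁ s| = |p₂ s| says exactly that s is a matching.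
record Matching (H K : Hypergraph) (s : V H × V K → Bool) : Set where
  field
    e₁          : V H → Bool
    e₂          : V K → Bool
    e₁-edge     : E H e₁
    e₂-edge     : E K e₂
    ⊆e₁×e₂      : s ⊆ e₁ ×ˢ e₂
    rightUnique : RightUnique s
    leftUnique  : LeftUnique s
    card≡min    : card (H ⊠ K) s ≡ card H e₁ ⊓ card K e₂

module _ {H K : Hypergraph} {s : V H × V K → Bool} where

  matching⇒dirEdge : Matching H K s → DirEdge H K s
  matching⇒dirEdge m = e₁ , e₂ , e₁-edge , e₂-edge , (λ x y → ∧-true⁻ ∘ ⊆e₁×e₂ (x , y)) , card≡min
    , trans (sym (rightUnique⇒card-p₁ H K s rightUnique)) card≡min
    , trans (sym (leftUnique⇒card-p₂ H K s leftUnique)) card≡min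
    where open Matching m

  dirEdge⇒matching : DirEdge H K s → Matching H K s
  dirEdge⇒matching (e₁ , e₂ , e₁-edge , e₂-edge , sub , c , c₁ , c₂) = record
    { e₁ = e₁ ; e₂ = e₂ ; e₁-edge = e₁-edge ; e₂-edge = e₂-edge
    ; ⊆e₁×e₂      = λ { (x , y) p → let x∈e₁ , y∈e₂ = sub x y p in ∧-true⁺ x∈e₁ y∈e₂ }
    ; rightUnique = card-p₁⇒rightUnique H K s (trans c (sym c₁))
    ; leftUnique  = card-p₂⇒leftUnique H K s (trans c (sym c₂))
    ; card≡min    = c
    }

module MatchingExtension (H K : Hypergraph) {a : V H → Bool} {b : V K → Bool} {P : V H × V K → Bool}
                         (P⊆a×b : P ⊆ a ×ˢ b) (P-ru : RightUnique P) (P-lu : LeftUnique P) where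

  free₁ : V H → Bool
  free₁ y = a y ∧ not (p₁ H K P y)

  free₂ : V K → Bool
  free₂ z = b z ∧ not (p₂ H K P z)

  -- The k-th unmatched vertex of a is paired with the k-th unmatched vertex of b.
  Paired : V H → V K → Set
  Paired y z = y ∈ free₁ × z ∈ free₂ × position H free₁ y ≡ position K free₂ z

  extension : V H × V K → Bool
  extension (y , z) = P (y , z) ∨ (free₁ y ∧ free₂ z ∧ ⌊ position H free₁ y ℕ.≟ position K free₂ z ⌋)

  P⊆extension : P ⊆ extension
  P⊆extension _ = ∨-true⁺ˡ

  paired⇒∈extension : ∀ {y z} → Paired y z → (y , z) ∈ extension
  paired⇒∈extension {y} {z} (y∈f₁ , z∈f₂ , same) = ∨-true⁺ʳ {P (y , z)}
    (∧-true⁺ y∈f₁ (∧-true⁺ z∈f₂ (isYes⁺ (position H free₁ y ℕ.≟ position K free₂ z) same)))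

  ∈extension⁻ : ∀ {y z} → (y , z) ∈ extension → (y , z) ∈ P ⊎ Paired y z
  ∈extension⁻ {y} {z} p with ∨-true⁻ {P (y , z)} p
  ... | inj₁ yz∈P = inj₁ yz∈P
  ... | inj₂ q    = let y∈f₁ , r = ∧-true⁻ q ; z∈f₂ , same = ∧-true⁻ r
                    in inj₂ (y∈f₁ , z∈f₂ , isYes⁻ (position H free₁ y ℕ.≟ position K free₂ z) same)

  extension⊆a×b : extension ⊆ a ×ˢ b
  extension⊆a×b (y , z) p with ∈extension⁻ p
  ... | inj₁ yz∈P              = P⊆a×b (y , z) yz∈P
  ... | inj₂ (y∈f₁ , z∈f₂ , _) = ∧-true⁺ (proj₁ (∧-true⁻ {a y} y∈f₁)) (proj₁ (∧-true⁻ {b z} z∈f₂))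

  private
    matched₁-not-free : ∀ {y z} → (y , z) ∈ P → ¬ y ∈ free₁
    matched₁-not-free {y} yz∈P y∈f₁ = ≡true⇒≢false (p₁⁺ H K P yz∈P) (not-true⁻ (proj₂ (∧-true⁻ {a y} y∈f₁)))

    matched₂-not-free : ∀ {y z} → (y , z) ∈ P → ¬ z ∈ free₂
    matched₂-not-free {z = z} yz∈P z∈f₂ = ≡true⇒≢false (p₂⁺ H K P yz∈P) (not-true⁻ (proj₂ (∧-true⁻ {b z} z∈f₂)))

  extension-rightUnique : RightUnique extension
  extension-rightUnique p p' with ∈extension⁻ p | ∈extension⁻ p'
  ... | inj₁ q             | inj₁ q'               = P-ru q q'
  ... | inj₁ q             | inj₂ (y∈f₁ , _)       = ⊥-elim (matched₁-not-free q y∈f₁)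
  ... | inj₂ (y∈f₁ , _)    | inj₁ q'               = ⊥-elim (matched₁-not-free q' y∈f₁)
  ... | inj₂ (_ , z∈f₂ , r) | inj₂ (_ , z'∈f₂ , r') = position-injective K free₂ z∈f₂ z'∈f₂ (trans (sym r) r')

  extension-leftUnique : LeftUnique extension
  extension-leftUnique p p' with ∈extension⁻ p | ∈extension⁻ p'
  ... | inj₁ q              | inj₁ q'                = P-lu q q'
  ... | inj₁ q              | inj₂ (_ , z∈f₂ , _)    = ⊥-elim (matched₂-not-free q z∈f₂)
  ... | inj₂ (_ , z∈f₂ , _) | inj₁ q'                = ⊥-elim (matched₂-not-free q' z∈f₂)
  ... | inj₂ (y∈f₁ , _ , r) | inj₂ (y'∈f₁ , _ , r')  = position-injective H free₁ y∈f₁ y'∈f₁ (trans r (sym r'))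

  p₁-extension⊆a : p₁ H K extension ⊆ a
  p₁-extension⊆a y p = let z , yz∈g = p₁⁻ H K extension p in proj₁ (∧-true⁻ (extension⊆a×b (y , z) yz∈g))

  p₂-extension⊆b : p₂ H K extension ⊆ b
  p₂-extension⊆b z p = let y , yz∈g = p₂⁻ H K extension p in proj₂ (∧-true⁻ (extension⊆a×b (y , z) yz∈g))

  a⊆p₁-extension : card H free₁ ≤ card K free₂ → a ⊆ p₁ H K extension
  a⊆p₁-extension f₁≤f₂ y y∈a with p₁ H K P y B.≟ true
  ... | yes y∈p₁P = let z , yz∈P = p₁⁻ H K P y∈p₁P in p₁⁺ H K extension (P⊆extension (y , z) yz∈P)
  ... | no  y∉p₁P = p₁⁺ H K extension (paired⇒∈extension (y∈f₁ , z∈f₂ , sym same))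
    where
    y∈f₁ : y ∈ free₁
    y∈f₁ = ∧-true⁺ y∈a (not-true⁺ (¬-not y∉p₁P))
    partner = position-surjective K free₂ (<-≤-trans (position-< H free₁ y∈f₁) f₁≤f₂)
    z∈f₂   = proj₁ (proj₂ partner)
    same   = proj₂ (proj₂ partner)

  b⊆p₂-extension : card K free₂ ≤ card H free₁ → b ⊆ p₂ H K extension
  b⊆p₂-extension f₂≤f₁ z z∈b with p₂ H K P z B.≟ true
  ... | yes z∈p₂P = let y , yz∈P = p₂⁻ H K P z∈p₂P in p₂⁺ H K extension (P⊆extension (y , z) yz∈P)
  ... | no  z∉p₂P = p₂⁺ H K extension (paired⇒∈extension (y∈f₁ , z∈f₂ , same))
    where
    z∈f₂ : z ∈ free₂
    z∈f₂ = ∧-true⁺ z∈b (not-true⁺ (¬-not z∉p₂P))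
    partner = position-surjective H free₁ (<-≤-trans (position-< K free₂ z∈f₂) f₂≤f₁)
    y∈f₁   = proj₁ (proj₂ partner)
    same   = proj₂ (proj₂ partner)

  card-extension : card (H ⊠ K) extension ≡ card H a ⊓ card K b
  card-extension with ≤-total (card H free₁) (card K free₂)
  ... | inj₁ f₁≤f₂ = trans g≡a (sym (m≤n⇒m⊓n≡m a≤b))
    where
    g≡a : card (H ⊠ K) extension ≡ card H a
    g≡a = trans (rightUnique⇒card-p₁ H K extension extension-rightUnique)
                (card-cong H p₁-extension⊆a (a⊆p₁-extension f₁≤f₂))
    a≤b : card H a ≤ card K b
    a≤b = ≤-trans (≤-reflexive (trans (sym g≡a) (leftUnique⇒card-p₂ H K extension extension-leftUnique)))
                  (card-mono K p₂-extension⊆b)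
  ... | inj₂ f₂≤f₁ = trans g≡b (sym (m≥n⇒m⊓n≡n b≤a))
    where
    g≡b : card (H ⊠ K) extension ≡ card K b
    g≡b = trans (leftUnique⇒card-p₂ H K extension extension-leftUnique)
                (card-cong K p₂-extension⊆b (b⊆p₂-extension f₂≤f₁))
    b≤a : card K b ≤ card H a
    b≤a = ≤-trans (≤-reflexive (trans (sym g≡b) (rightUnique⇒card-p₁ H K extension extension-rightUnique)))
                  (card-mono H p₁-extension⊆a)

×ˢ-congˡ : {A B : Set} {s s' : A → Bool} {t : B → Bool} → s ≗ s' → s ×ˢ t ≗ s' ×ˢ t
×ˢ-congˡ {t = t} s≗s' (x , y) = cong (_∧ t y) (s≗s' x)

×ˢ-congʳ : {A B : Set} {s : A → Bool} {t t' : B → Bool} → t ≗ t' → s ×ˢ t ≗ s ×ˢ t'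
×ˢ-congʳ {s = s} t≗t' (x , y) = cong (s x ∧_) (t≗t' y)

single-⊠ : (H K : Hypergraph) (v : V H) (w : V K) → single (H ⊠ K) (v , w) ≗ single H v ×ˢ single K w
single-⊠ H K v w (x , y) = eqV-⊠ H K x v y w

card-≗ : (H : Hypergraph) {s t : V H → Bool} → s ≗ t → card H s ≡ card H t
card-≗ H s≗t = card-cong H (λ x p → trans (sym (s≗t x)) p) (λ x p → trans (s≗t x) p)

module _ (H K : Hypergraph) where

  card-×ˢ-single : ∀ s w → card (H ⊠ K) (s ×ˢ single K w) ≡ card H s
  card-×ˢ-single s w = card-≡-bijection (H ⊠ K) H proj₁ (λ (x , _) → proj₁ ∘ ∧-true⁻ {s x}) inj onto
    where
    inj : InjectiveOn proj₁ (s ×ˢ single K w)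
    inj {x , y} {_ , y'} p p' refl = cong (x ,_)
      (trans (eqV-sound K (proj₂ (∧-true⁻ {s x} p))) (sym (eqV-sound K (proj₂ (∧-true⁻ {s x} p')))))
    onto : Onto proj₁ (s ×ˢ single K w) s
    onto x x∈s = (x , w) , ∧-true⁺ x∈s (eqV-refl K w) , refl

  card-single-×ˢ : ∀ v t → card (H ⊠ K) (single H v ×ˢ t) ≡ card K t
  card-single-×ˢ v t = card-≡-bijection (H ⊠ K) K proj₂ (λ (x , _) → proj₂ ∘ ∧-true⁻ {eqV H x v}) inj onto
    where
    inj : InjectiveOn proj₂ (single H v ×ˢ t)
    inj {x , y} {x' , _} p p' refl = cong (_, y)
      (trans (eqV-sound H (proj₁ (∧-true⁻ {eqV H x v} p))) (sym (eqV-sound H (proj₁ (∧-true⁻ {eqV H x' v} p')))))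
    onto : Onto proj₂ (single H v ×ˢ t) t
    onto y y∈t = (v , y) , ∧-true⁺ (eqV-refl H v) y∈t , refl

  vertex×edge : (v : V H) {f : V K → Bool} {s : V H × V K → Bool} →
                E K f → s ≗ single H v ×ˢ f → E (H ⊠ K) s
  vertex×edge v f∈E s≗ = inj₁ (inj₁ (v , _ , f∈E , λ x y → s≗ (x , y)))

  edge×vertex : {e : V H → Bool} (w : V K) {s : V H × V K → Bool} →
                E H e → s ≗ e ×ˢ single K w → E (H ⊠ K) s
  edge×vertex w e∈E s≗ = inj₁ (inj₂ (_ , w , e∈E , λ x y → s≗ (x , y)))

  matching : {s : V H × V K → Bool} → Matching H K s → E (H ⊠ K) s
  matching = inj₂ ∘ matching⇒dirEdge

EdgesPullBack : (H K : Hypergraph) → (V K → V H) → Set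
EdgesPullBack H K ψ = ∀ e → E H e → E K (e ∘ ψ)

module Reassociation (H₁ H₂ H₃ : Hypergraph) where

  private
    L = H₁ ⊠ H₂
    R = H₂ ⊠ H₃

  reassoc : (V L × V H₃ → Bool) → V H₁ × V R → Bool
  reassoc e = e ∘ Inverse.from assoc↔

  card-reassoc : ∀ e → card (H₁ ⊠ R) (reassoc e) ≡ card (L ⊠ H₃) e
  card-reassoc = card-preimage (H₁ ⊠ R) (L ⊠ H₃) (↔-sym assoc↔)

  reassoc-×ˢ : ∀ {e} s t u → e ≗ (s ×ˢ t) ×ˢ u → reassoc e ≗ s ×ˢ (t ×ˢ u)
  reassoc-×ˢ s t u e≗ (x , y , z) = trans (e≗ ((x , y) , z)) (∧-assoc (s x) (t y) (u z))

  reassoc-vertex×edge : (v : V L) {f : V H₃ → Bool} {e : V L × V H₃ → Bool} →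
                        E H₃ f → e ≗ single L v ×ˢ f → E (H₁ ⊠ R) (reassoc e)
  reassoc-vertex×edge (v₁ , v₂) {f} f∈E e≗ =
    vertex×edge H₁ R v₁ (vertex×edge H₂ H₃ v₂ f∈E (λ _ → refl))
      (reassoc-×ˢ (single H₁ v₁) (single H₂ v₂) _ (λ w → trans (e≗ w) (×ˢ-congˡ {t = f} (single-⊠ H₁ H₂ v₁ v₂) w)))

  module _ {e : V L × V H₃ → Bool} {e' : V L → Bool} (w₃ : V H₃) (e≗ : e ≗ e' ×ˢ single H₃ w₃) where

    reassoc-vertex×edge×vertex : (v₁ : V H₁) {f₂ : V H₂ → Bool} →
                                 E H₂ f₂ → e' ≗ single H₁ v₁ ×ˢ f₂ → E (H₁ ⊠ R) (reassoc e)
    reassoc-vertex×edge×vertex v₁ {f₂} f₂∈E e'≗ =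
      vertex×edge H₁ R v₁ (edge×vertex H₂ H₃ w₃ f₂∈E (λ _ → refl))
        (reassoc-×ˢ (single H₁ v₁) f₂ (single H₃ w₃) (λ w → trans (e≗ w) (×ˢ-congˡ {t = single H₃ w₃} e'≗ w)))

    reassoc-edge×vertex×vertex : (w₂ : V H₂) {e₁ : V H₁ → Bool} →
                                 E H₁ e₁ → e' ≗ e₁ ×ˢ single H₂ w₂ → E (H₁ ⊠ R) (reassoc e)
    reassoc-edge×vertex×vertex w₂ {e₁} e₁∈E e'≗ =
      edge×vertex H₁ R (w₂ , w₃) e₁∈E
        (λ w → trans (reassoc-×ˢ e₁ (single H₂ w₂) (single H₃ w₃) (λ w → trans (e≗ w) (×ˢ-congˡ {t = single H₃ w₃} e'≗ w)) w)
                     (sym (×ˢ-congʳ {s = e₁} (single-⊠ H₂ H₃ w₂ w₃) w)))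

    reassoc-matching×vertex : Matching H₁ H₂ e' → E (H₁ ⊠ R) (reassoc e)
    reassoc-matching×vertex m = matching H₁ R (record
      { e₁ = e₁ ; e₂ = e₂ ×ˢ single H₃ w₃
      ; e₁-edge = e₁-edge ; e₂-edge = edge×vertex H₂ H₃ w₃ e₂-edge (λ _ → refl)
      ; ⊆e₁×e₂ = λ { (x , y , z) q → let xy∈e' , z≡w₃ = ∈e⁻ q ; x∈e₁ , y∈e₂ = ∧-true⁻ {e₁ x} (⊆e₁×e₂ (x , y) xy∈e')
                                     in ∧-true⁺ x∈e₁ (∧-true⁺ y∈e₂ (eqV-complete H₃ z≡w₃)) }
      ; rightUnique = λ p p' → cong₂ _,_ (rightUnique (proj₁ (∈e⁻ p)) (proj₁ (∈e⁻ p')))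
                                          (trans (proj₂ (∈e⁻ p)) (sym (proj₂ (∈e⁻ p'))))
      ; leftUnique = λ p p' → leftUnique (proj₁ (∈e⁻ p)) (proj₁ (∈e⁻ p'))
      ; card≡min = begin
          card (H₁ ⊠ R) (reassoc e)                      ≡⟨ card-reassoc e ⟩
          card (L ⊠ H₃) e                                ≡⟨ card-≗ (L ⊠ H₃) e≗ ⟩
          card (L ⊠ H₃) (e' ×ˢ single H₃ w₃)            ≡⟨ card-×ˢ-single L H₃ e' w₃ ⟩
          card L e'                                      ≡⟨ card≡min ⟩
          card H₁ e₁ ⊓ card H₂ e₂                        ≡⟨ cong (card H₁ e₁ ⊓_) (sym (card-×ˢ-single H₂ H₃ e₂ w₃)) ⟩
          card H₁ e₁ ⊓ card R (e₂ ×ˢ single H₃ w₃)      ∎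
      })
      where
      open Matching m
      open ≡-Reasoning
      ∈e⁻ : ∀ {xy z} → (xy , z) ∈ e → xy ∈ e' × z ≡ w₃
      ∈e⁻ {xy} q = let xy∈e' , z≡w₃ = ∧-true⁻ {e' xy} (trans (sym (e≗ _)) q) in xy∈e' , eqV-sound H₃ z≡w₃

    reassoc-×vertex : E L e' → E (H₁ ⊠ R) (reassoc e)
    reassoc-×vertex (inj₁ (inj₁ (v₁ , _ , f₂∈E , e'≗))) = reassoc-vertex×edge×vertex v₁ f₂∈E (uncurry e'≗)
    reassoc-×vertex (inj₁ (inj₂ (_ , w₂ , e₁∈E , e'≗))) = reassoc-edge×vertex×vertex w₂ e₁∈E (uncurry e'≗)
    reassoc-×vertex (inj₂ d)                             = reassoc-matching×vertex (dirEdge⇒matching d)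

  module _ {e : V L × V H₃ → Bool} (m : Matching L H₃ e) where
    open Matching m renaming (e₁ to e'; e₂ to e₃; e₁-edge to e'-edge; e₂-edge to e₃-edge)
    open ≡-Reasoning

    private
      ∈e⁻ : ∀ {xy z} → (xy , z) ∈ e → xy ∈ e' × z ∈ e₃
      ∈e⁻ {xy} q = ∧-true⁻ {e' xy} (⊆e₁×e₂ _ q)

    reassoc-matching-on-vertex×edge : (v₁ : V H₁) {f₂ : V H₂ → Bool} →
                                      E H₂ f₂ → e' ≗ single H₁ v₁ ×ˢ f₂ → E (H₁ ⊠ R) (reassoc e)
    reassoc-matching-on-vertex×edge v₁ {f₂} f₂∈E e'≗ = vertex×edge H₁ R v₁ (matching H₂ H₃ slice-matching) reassoc-e≗
      where
      slice : V R → Bool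
      slice (y , z) = e ((v₁ , y) , z)

      ∈e'⁻ : ∀ {x y} → (x , y) ∈ e' → x ≡ v₁ × y ∈ f₂
      ∈e'⁻ {x} p = let x≡v₁ , y∈f₂ = ∧-true⁻ {eqV H₁ x v₁} (trans (sym (e'≗ _)) p) in eqV-sound H₁ x≡v₁ , y∈f₂

      ∈e⇒≡v₁ : ∀ {x y z} → ((x , y) , z) ∈ e → x ≡ v₁
      ∈e⇒≡v₁ q = proj₁ (∈e'⁻ (proj₁ (∈e⁻ q)))

      reassoc-e≗ : reassoc e ≗ single H₁ v₁ ×ˢ slice
      reassoc-e≗ (x , y , z) = ≡true-ext
        (λ q → case ∈e⇒≡v₁ q of λ { refl → ∧-true⁺ (eqV-refl H₁ x) q })
        (λ q → let x≡v₁ , q' = ∧-true⁻ {eqV H₁ x v₁} q in subst (λ u → ((u , y) , z) ∈ e) (sym (eqV-sound H₁ x≡v₁)) q')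

      slice-matching : Matching H₂ H₃ slice
      slice-matching = record
        { e₁ = f₂ ; e₂ = e₃ ; e₁-edge = f₂∈E ; e₂-edge = e₃-edge
        ; ⊆e₁×e₂ = λ (y , z) q → ∧-true⁺ (proj₂ (∈e'⁻ (proj₁ (∈e⁻ q)))) (proj₂ (∈e⁻ q))
        ; rightUnique = rightUnique
        ; leftUnique = λ p p' → cong proj₂ (leftUnique p p')
        ; card≡min = begin
            card R slice                    ≡⟨ card-≡-bijection R (L ⊠ H₃) (λ (y , z) → (v₁ , y) , z) (λ _ q → q)
                                                 (λ { p p' refl → refl }) onto ⟩
            card (L ⊠ H₃) e                 ≡⟨ card≡min ⟩
            card L e' ⊓ card H₃ e₃          ≡⟨ cong (_⊓ card H₃ e₃) (trans (card-≗ L e'≗) (card-single-×ˢ H₁ H₂ v₁ f₂)) ⟩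
            card H₂ f₂ ⊓ card H₃ e₃         ∎
        }
        where
        onto : Onto (λ (y , z) → (v₁ , y) , z) slice e
        onto ((x , y) , z) q = case ∈e⇒≡v₁ q of λ { refl → (y , z) , q , refl }

    reassoc-matching-on-edge×vertex : (w₂ : V H₂) {e₁ : V H₁ → Bool} →
                                      E H₁ e₁ → e' ≗ e₁ ×ˢ single H₂ w₂ → E (H₁ ⊠ R) (reassoc e)
    reassoc-matching-on-edge×vertex w₂ {e₁} e₁∈E e'≗ = matching H₁ R (record
      { e₁ = e₁ ; e₂ = single H₂ w₂ ×ˢ e₃
      ; e₁-edge = e₁∈E ; e₂-edge = vertex×edge H₂ H₃ w₂ e₃-edge (λ _ → refl)
      ; ⊆e₁×e₂ = λ { (x , y , z) q → let x∈e₁ , y≡w₂ = ∈e'⁻ (proj₁ (∈e⁻ q))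
                                     in ∧-true⁺ x∈e₁ (∧-true⁺ (eqV-complete H₂ y≡w₂) (proj₂ (∈e⁻ q))) }
      ; rightUnique = reassoc-rightUnique
      ; leftUnique = λ p p' → cong proj₁ (leftUnique p p')
      ; card≡min = begin
          card (H₁ ⊠ R) (reassoc e)             ≡⟨ card-reassoc e ⟩
          card (L ⊠ H₃) e                       ≡⟨ card≡min ⟩
          card L e' ⊓ card H₃ e₃                ≡⟨ cong₂ _⊓_ (trans (card-≗ L e'≗) (card-×ˢ-single H₁ H₂ e₁ w₂))
                                                             (sym (card-single-×ˢ H₂ H₃ w₂ e₃)) ⟩
          card H₁ e₁ ⊓ card R (single H₂ w₂ ×ˢ e₃) ∎
      })
      where
      ∈e'⁻ : ∀ {x y} → (x , y) ∈ e' → x ∈ e₁ × y ≡ w₂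
      ∈e'⁻ {x} p = let x∈e₁ , y≡w₂ = ∧-true⁻ {e₁ x} (trans (sym (e'≗ _)) p) in x∈e₁ , eqV-sound H₂ y≡w₂

      reassoc-rightUnique : RightUnique (reassoc e)
      reassoc-rightUnique {x} {y , z} {y' , z'} p p'
        with trans (proj₂ (∈e'⁻ (proj₁ (∈e⁻ p)))) (sym (proj₂ (∈e'⁻ (proj₁ (∈e⁻ p')))))
      ... | refl = cong (y ,_) (rightUnique p p')

    module _ (m' : Matching H₁ H₂ e') where
      open Matching m' using (e₁; e₂; e₁-edge; e₂-edge)
        renaming (⊆e₁×e₂ to ⊆e₁×e₂′; rightUnique to rightUnique′; leftUnique to leftUnique′; card≡min to card≡min′)

      private
        P : V R → Bool
        P = p₂ H₁ R (reassoc e)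

        P⊆e₂×e₃ : P ⊆ e₂ ×ˢ e₃
        P⊆e₂×e₃ (y , z) q = let x , q' = p₂⁻ H₁ R (reassoc e) q
                            in ∧-true⁺ (proj₂ (∧-true⁻ {e₁ x} (⊆e₁×e₂′ _ (proj₁ (∈e⁻ q'))))) (proj₂ (∈e⁻ q'))

        P-rightUnique : RightUnique P
        P-rightUnique q q' with p₂⁻ H₁ R (reassoc e) q | p₂⁻ H₁ R (reassoc e) q'
        ... | x , p | x' , p' with leftUnique′ (proj₁ (∈e⁻ p)) (proj₁ (∈e⁻ p'))
        ...   | refl = rightUnique p p'

        P-leftUnique : LeftUnique P
        P-leftUnique q q' with p₂⁻ H₁ R (reassoc e) q | p₂⁻ H₁ R (reassoc e) q'
        ... | x , p | x' , p' = cong proj₂ (leftUnique p p')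

      -- P is only a partial matching between e₂ and e₃; a maximum extension of it is the
      -- required edge of H₂ ⊠ H₃.
      open MatchingExtension H₂ H₃ {e₂} {e₃} P⊆e₂×e₃ P-rightUnique P-leftUnique

      extension-matching : Matching H₂ H₃ extension
      extension-matching = record
        { e₁ = e₂ ; e₂ = e₃ ; e₁-edge = e₂-edge ; e₂-edge = e₃-edge
        ; ⊆e₁×e₂ = extension⊆a×b ; rightUnique = extension-rightUnique
        ; leftUnique = extension-leftUnique ; card≡min = card-extension
        }

      reassoc-rightUnique : RightUnique (reassoc e)
      reassoc-rightUnique {x} {y , z} {y' , z'} p p' with rightUnique′ (proj₁ (∈e⁻ p)) (proj₁ (∈e⁻ p'))
      ... | refl = cong (y ,_) (rightUnique p p')

      reassoc-matching-on-matching : E (H₁ ⊠ R) (reassoc e)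
      reassoc-matching-on-matching = matching H₁ R (record
        { e₁ = e₁ ; e₂ = extension
        ; e₁-edge = e₁-edge ; e₂-edge = matching H₂ H₃ extension-matching
        ; ⊆e₁×e₂ = λ { (x , yz) q → ∧-true⁺ (proj₁ (∧-true⁻ {e₁ x} (⊆e₁×e₂′ _ (proj₁ (∈e⁻ q)))))
                                            (P⊆extension yz (p₂⁺ H₁ R (reassoc e) q)) }
        ; rightUnique = reassoc-rightUnique
        ; leftUnique = λ p p' → cong proj₁ (leftUnique p p')
        ; card≡min = begin
            card (H₁ ⊠ R) (reassoc e)                  ≡⟨ card-reassoc e ⟩
            card (L ⊠ H₃) e                            ≡⟨ card≡min ⟩
            card L e' ⊓ card H₃ e₃                     ≡⟨ cong (_⊓ card H₃ e₃) card≡min′ ⟩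
            (card H₁ e₁ ⊓ card H₂ e₂) ⊓ card H₃ e₃     ≡⟨ ⊓-assoc (card H₁ e₁) (card H₂ e₂) (card H₃ e₃) ⟩
            card H₁ e₁ ⊓ (card H₂ e₂ ⊓ card H₃ e₃)     ≡⟨ cong (card H₁ e₁ ⊓_) (sym card-extension) ⟩
            card H₁ e₁ ⊓ card R extension              ∎
        })

    reassoc-matching : E (H₁ ⊠ R) (reassoc e)
    reassoc-matching with e'-edge
    ... | inj₁ (inj₁ (v₁ , _ , f₂∈E , e'≗)) = reassoc-matching-on-vertex×edge v₁ f₂∈E (uncurry e'≗)
    ... | inj₁ (inj₂ (_ , w₂ , e₁∈E , e'≗)) = reassoc-matching-on-edge×vertex w₂ e₁∈E (uncurry e'≗)
    ... | inj₂ d                            = reassoc-matching-on-matching (dirEdge⇒matching d)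

  reassoc-edge : EdgesPullBack (L ⊠ H₃) (H₁ ⊠ R) (Inverse.from assoc↔)
  reassoc-edge e (inj₁ (inj₁ (v , _ , f∈E , e≗)))   = reassoc-vertex×edge v f∈E (uncurry e≗)
  reassoc-edge e (inj₁ (inj₂ (_ , w₃ , e'∈E , e≗))) = reassoc-×vertex w₃ (uncurry e≗) e'∈E
  reassoc-edge e (inj₂ d)                           = reassoc-matching (dirEdge⇒matching d)

⊠-comm : (H K : Hypergraph) → EdgesPullBack (H ⊠ K) (K ⊠ H) swap
⊠-comm H K s (inj₁ (inj₁ (v , f , f∈E , s≗))) =
  edge×vertex K H v f∈E (λ (y , x) → trans (s≗ x y) (∧-comm (eqV H x v) (f y)))
⊠-comm H K s (inj₁ (inj₂ (e , w , e∈E , s≗))) =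
  vertex×edge K H w e∈E (λ (y , x) → trans (s≗ x y) (∧-comm (e x) (eqV K y w)))
⊠-comm H K s (inj₂ d) = matching K H (record
  { e₁ = e₂ ; e₂ = e₁ ; e₁-edge = e₂-edge ; e₂-edge = e₁-edge
  ; ⊆e₁×e₂ = λ (y , x) q → let x∈e₁ , y∈e₂ = ∧-true⁻ {e₁ x} (⊆e₁×e₂ (x , y) q) in ∧-true⁺ y∈e₂ x∈e₁
  ; rightUnique = leftUnique
  ; leftUnique = rightUnique
  ; card≡min = trans (card-preimage (K ⊠ H) (H ⊠ K) (×-comm _ _) s)
                     (trans card≡min (⊓-comm (card H e₁) (card K e₂)))
  })
  where open Matching (dirEdge⇒matching {H} {K} d)

eqV-↔ : (H H' : Hypergraph) (ψ : V H' ↔ V H) (x : V H') (v : V H) →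
        eqV H (Inverse.to ψ x) v ≡ eqV H' x (Inverse.from ψ v)
eqV-↔ H H' ψ x v = ≡true-ext
  (λ p → eqV-complete H' (sym (Inverse.inverseʳ ψ (sym (eqV-sound H p)))))
  (λ p → eqV-complete H (Inverse.inverseˡ ψ (eqV-sound H' p)))

⊠-congˡ : (H H' K : Hypergraph) (ψ : V H' ↔ V H) → EdgesPullBack H H' (Inverse.to ψ) →
          EdgesPullBack (H ⊠ K) (H' ⊠ K) (map₁ (Inverse.to ψ))
⊠-congˡ H H' K ψ pull s (inj₁ (inj₁ (v , f , f∈E , s≗))) =
  vertex×edge H' K (Inverse.from ψ v) f∈E (λ (x , y) → trans (s≗ _ y) (cong (_∧ f y) (eqV-↔ H H' ψ x v)))
⊠-congˡ H H' K ψ pull s (inj₁ (inj₂ (e , w , e∈E , s≗))) =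
  edge×vertex H' K w (pull e e∈E) (λ (x , y) → s≗ _ y)
⊠-congˡ H H' K ψ pull s (inj₂ d) = matching H' K (record
  { e₁ = e₁ ∘ Inverse.to ψ ; e₂ = e₂ ; e₁-edge = pull e₁ e₁-edge ; e₂-edge = e₂-edge
  ; ⊆e₁×e₂ = λ (x , y) → ⊆e₁×e₂ (Inverse.to ψ x , y)
  ; rightUnique = rightUnique
  ; leftUnique = λ p p' → Injection.injective (↔⇒↣ ψ) (leftUnique p p')
  ; card≡min = trans (card-preimage (H' ⊠ K) (H ⊠ K) (ψ ×-cong ↔-refl) s)
                     (trans card≡min (cong (_⊓ card K e₂) (sym (card-preimage H' H ψ e₁))))
  })
  where open Matching (dirEdge⇒matching {H} {K} d)

-- The inverse associator of H₁, H₂, H₃ is the associator of H₃, H₂, H₁ conjugated by commutations.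
reassoc⁻¹-edge : (H₁ H₂ H₃ : Hypergraph) →
                 EdgesPullBack (H₁ ⊠ (H₂ ⊠ H₃)) ((H₁ ⊠ H₂) ⊠ H₃) (Inverse.to assoc↔)
reassoc⁻¹-edge H₁ H₂ H₃ f =
    ⊠-congˡ (H₂ ⊠ H₁) (H₁ ⊠ H₂) H₃ (×-comm _ _) (⊠-comm H₂ H₁) _
  ∘ ⊠-comm H₃ (H₂ ⊠ H₁) _
  ∘ Reassociation.reassoc-edge H₃ H₂ H₁ _
  ∘ ⊠-congˡ (H₂ ⊠ H₃) (H₃ ⊠ H₂) H₁ (×-comm _ _) (⊠-comm H₂ H₃) _
  ∘ ⊠-comm H₁ (H₂ ⊠ H₃) f

proposition3p3 : (H₁ H₂ H₃ : Hypergraph) →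
    NonEmptyEdges H₁ → NonEmptyEdges H₂ → NonEmptyEdges H₃ →
    IsIsomorphism ((H₁ ⊠ H₂) ⊠ H₃) (H₁ ⊠ (H₂ ⊠ H₃)) assoc↔
    × Isomorphic ((H₁ ⊠ H₂) ⊠ H₃) (H₁ ⊠ (H₂ ⊠ H₃))
proposition3p3 H₁ H₂ H₃ _ _ _ = assoc-iso , assoc↔ , assoc-iso
  where
  assoc-iso : IsIsomorphism ((H₁ ⊠ H₂) ⊠ H₃) (H₁ ⊠ (H₂ ⊠ H₃)) assoc↔
  assoc-iso = Reassociation.reassoc-edge H₁ H₂ H₃ , reassoc⁻¹-edge H₁ H₂ H₃
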